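{- Let $r\ge0$ and $n\ge0$ be integers. The number of $r$-flourishing increasing ordered trees on $n+1$ nodes is $(2n-2r-1)!!\cdot(n-r)(n-r-1)\cdots(n-2r+1)$ if $n\ge2r$, and $0$ otherwise.
   Context: An increasing ordered tree on $n+1$ nodes is a rooted tree with nodes labeled $0,1,\dots,n$ such that labels increase along every path from the root to a leaf (so the root is $0$), together with a total order on the children of each node. Such a tree is $r$-flourishing if the root has at least $r$ children and none of the first $r$ children of the root (in the given order) is a leaf. Conventions: $(-1)!!=1$, and the empty product (for $r=0$) equals $1$. -}

module Defs where

open import Data.Nat using (ℕ; zero; suc; _+_; _*_; _∸_; _≤_; _<_)
open import Data.List using (List; []; _∷_; _++_; length; take; upTo)
open import Relation.Binary.PropositionalEquality using (_≡_)
open import Data.List.Relation.Unary.All using (All)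
open import Data.List.Relation.Unary.Unique.Propositional using (Unique)
open import Data.List.Membership.Propositional using (_∈_)
open import Data.List.Relation.Binary.Permutation.Propositional using (_↭_)
open import Data.Product using (Σ; _×_)
open import Function.Bundles using (_⇔_)

data Tree : Set where
  node : ℕ → List Tree → Tree

label : Tree → ℕ
label (node a _) = a

children : Tree → List Tree
children (node _ cs) = cs

mutual
  labels : Tree → List ℕ
  labels (node a cs) = a ∷ labelsF cs

  labelsF : List Tree → List ℕ
  labelsF []       = []
  labelsF (c ∷ cs) = labels c ++ labelsF cs

data Increasing : Tree → Set where
  inc : ∀ {a cs} → All (λ c → a < label c) cs → All Increasing cs →
        Increasing (node a cs)

-- increasing ordered tree on n+1 nodes: labels are exactly 0,1,…,n
-- (each used once) and increase along every root-to-leaf path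
IncreasingOrderedTree : ℕ → Tree → Set
IncreasingOrderedTree n t = Increasing t × (labels t ↭ upTo (suc n))

NotLeaf : Tree → Set
NotLeaf t = 0 < length (children t)

Flourishing : ℕ → Tree → Set
Flourishing r t = (r ≤ length (children t)) × All NotLeaf (take r (children t))

-- "the number of trees satisfying P is k": there is a duplicate-free
-- list of length k whose members are exactly the trees satisfying P
NumberOf : (Tree → Set) → ℕ → Set
NumberOf P k = Σ (List Tree) λ L → Unique L × (∀ t → (t ∈ L) ⇔ P t) × (length L ≡ k)

-- oddDoubleFactorial k = (2k-1)!! = 1·3·5·…·(2k-1), with (-1)!! = 1 for k = 0
oddDoubleFactorial : ℕ → ℕ
oddDoubleFactorial zero    = 1
oddDoubleFactorial (suc k) = suc (2 * k) * oddDoubleFactorial k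

-- Removing the largest label n + 1 from an increasing ordered tree on n + 2 nodes removes a leaf,
-- and the tree is recovered from the smaller one together with the slot the leaf occupied; a
-- forest on m nodes has 2m + 1 slots. So inserting n + 1 at every slot of every tree on n + 1
-- nodes lists each tree on n + 2 nodes exactly once.
--
-- For a pattern w of shapes (leaf or inner) prescribed for the first root children, an insertion
-- produces a tree matching w either from a tree already matching w, or from a tree matching a
-- predecessor pattern (a leaf demand dropped, or an inner demand weakened to a leaf). Counting
-- insertions gives a linear recurrence in n for the number of matching trees with a inner and
-- b leaf demands, and n P b · (2k − 1)!! · k P a with k = n − a − b satisfies it. The r-flourishing
-- trees are those matching r inner demands, so their number is (2(n − r) − 1)!! · (n − r) P r,
-- which vanishes when n < 2r.

module Submission where

open import Defs
open import Data.Bool using (Bool; true; false; T; _∧_)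
open import Data.Empty using (⊥-elim)
open import Data.Nat using (ℕ; zero; suc; pred; _+_; _*_; _∸_; _≤_; _<_; _≤ᵇ_; _≤?_; _<?_; z≤n; s≤s; s≤s⁻¹)
open import Data.Nat.Properties
  using (+-assoc; +-identityʳ; +-suc; +-cancelʳ-≡; *-assoc; *-identityˡ; *-zeroʳ; *-suc; *-distribˡ-+; *-distribʳ-+;
         *-commutativeSemigroup; suc-injective; ≤-refl; <-irrefl; <-trans; <-≤-trans; n<1+n; m≤n⇒m≤1+n; ≰⇒>; ≮⇒≥;
         ≤⇒≤ᵇ; 0∸n≡0; m≤n⇒m∸n≡0; m+n∸m≡n; m∸n+n≡m; m<n+o⇒m∸n<o; pred[m∸n]≡m∸[1+n]; m≤n⇒∃[o]m+o≡n)
open import Algebra.Properties.CommutativeSemigroup *-commutativeSemigroup using (x∙yz≈y∙xz)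
open import Data.Nat.Combinatorics using (_P_; k>n⇒nPk≡0)
open import Data.Nat.Combinatorics.Base using (_P′_)
open import Data.Nat.Tactic.RingSolver using (solve-∀)
open import Data.List using (List; []; _∷_; _++_; length; map; concatMap; take; replicate; filter; upTo)
open import Data.List.Properties using (∷-injectiveˡ; ∷-injectiveʳ; length-++; length-map; length-upTo; upTo-∷ʳ)
open import Data.List.Relation.Unary.All as All using (All; []; _∷_)
open import Data.List.Relation.Unary.All.Properties as All using ()
open import Data.List.Relation.Unary.AllPairs using ([]; _∷_)
open import Data.List.Relation.Unary.Any using (here; there)
open import Data.List.Relation.Unary.Unique.Propositional using (Unique)
open import Data.List.Relation.Unary.Unique.Propositional.Properties as Unique using ()
open import Data.List.Membership.Propositional using (_∈_; _∉_)
open import Data.List.Membership.Propositional.Properties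
  using (∈-++⁺ˡ; ∈-++⁺ʳ; ∈-++⁻; ∈-map⁺; ∈-map⁻; ∈-concat⁺′; ∈-concat⁻′; ∈-upTo⁺; ∈-upTo⁻; ∈-filter⁺; ∈-filter⁻)
open import Data.List.Relation.Binary.Permutation.Propositional
  using (_↭_; ↭-refl; ↭-prep; ↭-swap; ↭-sym; ↭-trans)
open import Data.List.Relation.Binary.Permutation.Propositional.Properties
  using (++⁺ˡ; ++⁺ʳ; shift; ∷↭∷ʳ; All-resp-↭; ∈-resp-↭; drop-∷; ↭-singleton-inv; ↭-length)
open import Data.Product using (Σ; _×_; _,_)
open import Data.Sum using (inj₁; inj₂)
open import Data.Unit using (tt)
open import Function.Base using (_∘_)
open import Function.Bundles using (mk⇔)
open import Relation.Nullary using (¬_; yes; no)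
open import Relation.Nullary.Decidable using (T?)
open import Relation.Binary.PropositionalEquality
  using (_≡_; refl; sym; trans; cong; cong₂; subst; module ≡-Reasoning)

-- Attaching a leaf to a forest

data Slot : List Tree → Set where
  front : ∀ {cs} → Slot cs
  into  : ∀ {b ds cs} → Slot ds → Slot (node b ds ∷ cs)
  past  : ∀ {c cs} → Slot cs → Slot (c ∷ cs)

insertLeaf : ℕ → {cs : List Tree} → Slot cs → List Tree
insertLeaf x {cs}             front    = node x [] ∷ cs
insertLeaf x {node b ds ∷ cs} (into s) = node b (insertLeaf x s) ∷ cs
insertLeaf x {c ∷ cs}         (past s) = c ∷ insertLeaf x s

slots : (cs : List Tree) → List (Slot cs)
slots []               = front ∷ []
slots (node b ds ∷ cs) = front ∷ map into (slots ds) ++ map past (slots cs)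

∈-slots : ∀ {cs} (s : Slot cs) → s ∈ slots cs
∈-slots {[]}             front    = here refl
∈-slots {node b ds ∷ cs} front    = here refl
∈-slots                  (into s) = there (∈-++⁺ˡ (∈-map⁺ into (∈-slots s)))
∈-slots {node b ds ∷ cs} (past s) = there (∈-++⁺ʳ (map into (slots ds)) (∈-map⁺ past (∈-slots s)))

slots-unique : ∀ cs → Unique (slots cs)
slots-unique []               = [] ∷ []
slots-unique (node b ds ∷ cs) =
  All.++⁺ (All.map⁺ {f = into} (All.universal (λ _ ()) (slots ds)))
          (All.map⁺ {f = past} (All.universal (λ _ ()) (slots cs)))
  ∷ Unique.++⁺ (Unique.map⁺ into-injective (slots-unique ds))
               (Unique.map⁺ past-injective (slots-unique cs))
               into≢past
  where
  into-injective : ∀ {s s'} → into {b} {ds} {cs} s ≡ into s' → s ≡ s'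
  into-injective refl = refl
  past-injective : ∀ {s s'} → past {node b ds} s ≡ past s' → s ≡ s'
  past-injective refl = refl
  into≢past : ∀ {v} → ¬ (v ∈ map into (slots ds) × v ∈ map past (slots cs))
  into≢past (p , q) with ∈-map⁻ into p | ∈-map⁻ past q
  ... | _ , _ , refl | _ , _ , ()

labelsF-insertLeaf : ∀ x {cs} (s : Slot cs) → labelsF (insertLeaf x s) ↭ x ∷ labelsF cs
labelsF-insertLeaf x front = ↭-refl
labelsF-insertLeaf x {node b ds ∷ cs} (into s) =
  ↭-trans (++⁺ʳ (labelsF cs) (↭-prep b (labelsF-insertLeaf x s))) (↭-swap b x ↭-refl)
labelsF-insertLeaf x {c ∷ cs} (past s) =
  ↭-trans (++⁺ˡ (labels c) (labelsF-insertLeaf x s)) (shift x (labels c) (labelsF cs))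

∈-insertLeaf : ∀ x {cs} (s : Slot cs) → x ∈ labelsF (insertLeaf x s)
∈-insertLeaf x front             = here refl
∈-insertLeaf x (into s)          = there (∈-++⁺ˡ (∈-insertLeaf x s))
∈-insertLeaf x {c ∷ cs} (past s) = ∈-++⁺ʳ (labels c) (∈-insertLeaf x s)

insertLeaf-increasing : ∀ {x a cs} (s : Slot cs) → All (_< x) (labels (node a cs)) →
  Increasing (node a cs) → Increasing (node a (insertLeaf x s))
insertLeaf-increasing front (a<x ∷ _) (inc p q) = inc (a<x ∷ p) (inc [] [] ∷ q)
insertLeaf-increasing {cs = node b ds ∷ cs} (into s) (_ ∷ bounds) (inc (p ∷ ps) (q ∷ qs)) =
  inc (p ∷ ps) (insertLeaf-increasing s (All.++⁻ˡ (labels (node b ds)) bounds) q ∷ qs)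
insertLeaf-increasing {cs = c ∷ cs} (past s) (a<x ∷ bounds) (inc (p ∷ ps) (q ∷ qs))
  with insertLeaf-increasing s (a<x ∷ All.++⁻ʳ (labels c) bounds) (inc ps qs)
... | inc ps' qs' = inc (p ∷ ps') (q ∷ qs')

insertLeaf-increasing⁻ : ∀ {x a cs} (s : Slot cs) →
  Increasing (node a (insertLeaf x s)) → Increasing (node a cs)
insertLeaf-increasing⁻ front    (inc (_ ∷ p) (_ ∷ q))   = inc p q
insertLeaf-increasing⁻ (into s) (inc (p ∷ ps) (q ∷ qs)) = inc (p ∷ ps) (insertLeaf-increasing⁻ s q ∷ qs)
insertLeaf-increasing⁻ (past s) (inc (p ∷ ps) (q ∷ qs)) with insertLeaf-increasing⁻ s (inc ps qs)
... | inc ps' qs' = inc (p ∷ ps') (q ∷ qs')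

root-minimal : ∀ {a cs} → Increasing (node a cs) → All (a <_) (labelsF cs)
root-minimal (inc [] []) = []
root-minimal (inc (p ∷ ps) (q@(inc _ _) ∷ qs)) =
  All.++⁺ (p ∷ All.map (<-trans p) (root-minimal q)) (root-minimal (inc ps qs))

maximum-is-leaf : ∀ {x ds} → Increasing (node x ds) → All (_≤ x) (labelsF ds) → ds ≡ []
maximum-is-leaf {ds = []}           _                  _         = refl
maximum-is-leaf {ds = node e _ ∷ _} (inc (x<e ∷ _) _) (e≤x ∷ _) = ⊥-elim (<-irrefl refl (<-≤-trans x<e e≤x))

maximum⇒insertLeaf : ∀ {x cs} → All Increasing cs → All (_≤ x) (labelsF cs) → x ∈ labelsF cs →
  Σ (List Tree) λ cs₀ → Σ (Slot cs₀) λ s → cs ≡ insertLeaf x s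
maximum⇒insertLeaf {cs = node b ds ∷ cs} (q ∷ qs) bounds x∈
  with All.++⁻ (labels (node b ds)) bounds | ∈-++⁻ (labels (node b ds)) x∈ | q
... | (_ ∷ bounds-ds) , _ | inj₁ (here refl) | _ with maximum-is-leaf q bounds-ds
...   | refl = cs , front , refl
maximum⇒insertLeaf {cs = node b ds ∷ cs} (q ∷ qs) bounds x∈
    | (_ ∷ bounds-ds) , _ | inj₁ (there x∈ds) | inc _ qs-ds with maximum⇒insertLeaf qs-ds bounds-ds x∈ds
...   | ds₀ , s , refl = node b ds₀ ∷ cs , into s , refl
maximum⇒insertLeaf {cs = node b ds ∷ cs} (q ∷ qs) bounds x∈
    | _ , bounds-cs | inj₂ x∈cs | _ with maximum⇒insertLeaf qs bounds-cs x∈cs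
...   | cs₀ , s , refl = node b ds ∷ cs₀ , past s , refl

insertLeaf-injective : ∀ {x cs cs'} (s : Slot cs) (s' : Slot cs') → x ∉ labelsF cs → x ∉ labelsF cs' →
  insertLeaf x s ≡ insertLeaf x s' → _≡_ {A = Σ (List Tree) Slot} (cs , s) (cs' , s')
insertLeaf-injective front front _ _ eq with ∷-injectiveʳ eq
... | refl = refl
insertLeaf-injective front (into s') _ x∉' eq = ⊥-elim (x∉' (here (cong label (∷-injectiveˡ eq))))
insertLeaf-injective (into s) front x∉ _ eq = ⊥-elim (x∉ (here (cong label (sym (∷-injectiveˡ eq)))))
insertLeaf-injective front (past s') _ x∉' eq =
  ⊥-elim (x∉' (∈-++⁺ˡ (subst (λ c → _ ∈ labels c) (∷-injectiveˡ eq) (here refl))))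
insertLeaf-injective (past s) front x∉ _ eq =
  ⊥-elim (x∉ (∈-++⁺ˡ (subst (λ c → _ ∈ labels c) (sym (∷-injectiveˡ eq)) (here refl))))
insertLeaf-injective {x} (into s) (past s') _ x∉' eq =
  ⊥-elim (x∉' (∈-++⁺ˡ (subst (λ c → x ∈ labels c) (∷-injectiveˡ eq) (there (∈-insertLeaf x s)))))
insertLeaf-injective {x} (past s) (into s') x∉ _ eq =
  ⊥-elim (x∉ (∈-++⁺ˡ (subst (λ c → x ∈ labels c) (sym (∷-injectiveˡ eq)) (there (∈-insertLeaf x s')))))
insertLeaf-injective (into s) (into s') x∉ x∉' eq
  with cong label (∷-injectiveˡ eq) | ∷-injectiveʳ eq
     | insertLeaf-injective s s' (x∉ ∘ there ∘ ∈-++⁺ˡ) (x∉' ∘ there ∘ ∈-++⁺ˡ) (cong children (∷-injectiveˡ eq))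
... | refl | refl | refl = refl
insertLeaf-injective {cs = c ∷ cs} {c' ∷ cs'} (past s) (past s') x∉ x∉' eq
  with ∷-injectiveˡ eq
... | refl with insertLeaf-injective s s' (x∉ ∘ ∈-++⁺ʳ (labels c)) (x∉' ∘ ∈-++⁺ʳ (labels c)) (∷-injectiveʳ eq)
...   | refl = refl

-- Enumerating increasing ordered trees

graft : ℕ → (t : Tree) → Slot (children t) → Tree
graft x t s = node (label t) (insertLeaf x s)

labels-graft : ∀ x t (s : Slot (children t)) → labels (graft x t s) ↭ x ∷ labels t
labels-graft x (node a cs) s = ↭-trans (↭-prep a (labelsF-insertLeaf x s)) (↭-swap a x ↭-refl)

graft-injective : ∀ {x t t'} (s : Slot (children t)) (s' : Slot (children t')) →
  x ∉ labels t → x ∉ labels t' → graft x t s ≡ graft x t' s' →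
  _≡_ {A = Σ Tree (Slot ∘ children)} (t , s) (t' , s')
graft-injective {t = node a cs} {node a' cs'} s s' x∉ x∉' eq
  with cong label eq | insertLeaf-injective s s' (x∉ ∘ there) (x∉' ∘ there) (cong children eq)
... | refl | refl = refl

extensions : ℕ → Tree → List Tree
extensions x t = map (graft x t) (slots (children t))

trees : ℕ → List Tree
trees zero    = node 0 [] ∷ []
trees (suc n) = concatMap (extensions (suc n)) (trees n)

∈-concatMap-extensions⁻ : ∀ {x t'} ts → t' ∈ concatMap (extensions x) ts →
  Σ Tree λ t → t ∈ ts × Σ (Slot (children t)) λ s → t' ≡ graft x t s
∈-concatMap-extensions⁻ {x} ts t'∈ with ∈-concat⁻′ (map (extensions x) ts) t'∈
... | _ , t'∈ext , ext∈ with ∈-map⁻ (extensions x) ext∈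
...   | t , t∈ , refl with ∈-map⁻ (graft x t) t'∈ext
...     | s , _ , refl = t , t∈ , s , refl

∈-concatMap-extensions⁺ : ∀ {x t ts} → t ∈ ts → (s : Slot (children t)) →
  graft x t s ∈ concatMap (extensions x) ts
∈-concatMap-extensions⁺ {x} {t} t∈ s =
  ∈-concat⁺′ (∈-map⁺ (graft x t) (∈-slots s)) (∈-map⁺ (extensions x) t∈)

All<⇒∉ : ∀ {x xs} → All (_< x) xs → x ∉ xs
All<⇒∉ bounds x∈ = <-irrefl refl (All.lookup bounds x∈)

upTo-suc↭ : ∀ m → upTo (suc m) ↭ m ∷ upTo m
upTo-suc↭ m = subst (_↭ m ∷ upTo m) (upTo-∷ʳ m) (↭-sym (∷↭∷ʳ m (upTo m)))

All<-upTo : ∀ m → All (_< m) (upTo m)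
All<-upTo m = All.tabulate ∈-upTo⁻

ordered⇒labels< : ∀ {n t} → IncreasingOrderedTree n t → All (_< suc n) (labels t)
ordered⇒labels< (_ , σ) = All-resp-↭ (↭-sym σ) (All<-upTo _)

trees-sound : ∀ n {t} → t ∈ trees n → IncreasingOrderedTree n t
trees-sound zero    (here refl) = inc [] [] , ↭-refl
trees-sound (suc n) t'∈ with ∈-concatMap-extensions⁻ (trees n) t'∈
... | t@(node a cs) , t∈ , s , refl with trees-sound n t∈
...   | ordered@(increasing , σ) =
  insertLeaf-increasing s (ordered⇒labels< ordered) increasing ,
  ↭-trans (labels-graft (suc n) t s) (↭-trans (↭-prep (suc n) σ) (↭-sym (upTo-suc↭ (suc n))))

ordered⇒root≡0 : ∀ {n a cs} → IncreasingOrderedTree n (node a cs) → a ≡ 0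
ordered⇒root≡0 (increasing , σ) with ∈-resp-↭ (↭-sym σ) (∈-upTo⁺ (s≤s z≤n))
... | here 0≡a   = sym 0≡a
... | there 0∈cs = ⊥-elim (<-irrefl refl (<-≤-trans (All.lookup (root-minimal increasing) 0∈cs) z≤n))

trees-complete : ∀ n {t} → IncreasingOrderedTree n t → t ∈ trees n
trees-complete zero {node a []} (_ , σ) with ↭-singleton-inv σ
... | refl = here refl
trees-complete zero {node a (node _ _ ∷ _)} (_ , σ) with ↭-singleton-inv σ
... | ()
trees-complete (suc n) {node a cs} ordered@(increasing@(inc _ qs) , σ)
  with ordered⇒root≡0 ordered | ∈-resp-↭ (↭-sym σ) (∈-upTo⁺ {i = suc n} ≤-refl)
-- the root label is 0, so suc n occurs below the root
... | refl | there max∈cs with ordered⇒labels< ordered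
...   | _ ∷ bounds with maximum⇒insertLeaf qs (All.map s≤s⁻¹ bounds) max∈cs
...     | cs₀ , s , refl =
  ∈-concatMap-extensions⁺ (trees-complete n (insertLeaf-increasing⁻ s increasing , σ₀)) s
  where
  σ₀ : labels (node a cs₀) ↭ upTo (suc n)
  σ₀ = drop-∷ (↭-trans (↭-sym (labels-graft (suc n) (node a cs₀) s)) (↭-trans σ (upTo-suc↭ (suc n))))

extensions-unique : ∀ {x} t → x ∉ labels t → Unique (extensions x t)
extensions-unique t x∉ = Unique.map⁺ graft-injectiveʳ (slots-unique (children t))
  where
  graft-injectiveʳ : ∀ {s s'} → graft _ t s ≡ graft _ t s' → s ≡ s'
  graft-injectiveʳ {s} {s'} eq with graft-injective s s' x∉ x∉ eq
  ... | refl = refl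

concatMap-extensions-unique : ∀ {x} ts → Unique ts → All (λ t → x ∉ labels t) ts →
  Unique (concatMap (extensions x) ts)
concatMap-extensions-unique [] _ _ = []
concatMap-extensions-unique {x} (t ∷ ts) (t∉ts ∷ ts-unique) (x∉t ∷ x∉ts) =
  Unique.++⁺ (extensions-unique t x∉t) (concatMap-extensions-unique ts ts-unique x∉ts) disjoint
  where
  disjoint : ∀ {v} → ¬ (v ∈ extensions x t × v ∈ concatMap (extensions x) ts)
  disjoint (v∈t , v∈ts) with ∈-map⁻ (graft x t) v∈t | ∈-concatMap-extensions⁻ ts v∈ts
  ... | s , _ , refl | t' , t'∈ , s' , eq with graft-injective s s' x∉t (All.lookup x∉ts t'∈) eq
  ...   | refl = All.lookup t∉ts t'∈ refl

trees-unique : ∀ n → Unique (trees n)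
trees-unique zero    = [] ∷ []
trees-unique (suc n) = concatMap-extensions-unique (trees n) (trees-unique n)
  (All.tabulate (λ t∈ → All<⇒∉ (ordered⇒labels< (trees-sound n t∈))))

-- Finite sums

private variable
  A B : Set

∑ : (A → ℕ) → List A → ℕ
∑ f []       = 0
∑ f (x ∷ xs) = f x + ∑ f xs

∑-++ : ∀ (f : A → ℕ) xs ys → ∑ f (xs ++ ys) ≡ ∑ f xs + ∑ f ys
∑-++ f []       ys = refl
∑-++ f (x ∷ xs) ys = trans (cong (f x +_) (∑-++ f xs ys)) (sym (+-assoc (f x) _ _))

∑-map : ∀ (f : B → ℕ) (g : A → B) xs → ∑ f (map g xs) ≡ ∑ (f ∘ g) xs
∑-map f g []       = refl
∑-map f g (x ∷ xs) = cong (f (g x) +_) (∑-map f g xs)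

∑-concatMap : ∀ (f : B → ℕ) (g : A → List B) xs →
  ∑ f (concatMap g xs) ≡ ∑ (∑ f ∘ g) xs
∑-concatMap f g []       = refl
∑-concatMap f g (x ∷ xs) = trans (∑-++ f (g x) (concatMap g xs)) (cong (∑ f (g x) +_) (∑-concatMap f g xs))

∑-cong : ∀ {f g : A → ℕ} xs → (∀ {x} → x ∈ xs → f x ≡ g x) → ∑ f xs ≡ ∑ g xs
∑-cong []       f≗g = refl
∑-cong (x ∷ xs) f≗g = cong₂ _+_ (f≗g (here refl)) (∑-cong xs (f≗g ∘ there))

∑-const : ∀ k (xs : List A) → ∑ (λ _ → k) xs ≡ length xs * k
∑-const k []       = refl
∑-const k (x ∷ xs) = cong (k +_) (∑-const k xs)

∑-zero : ∀ (xs : List A) → ∑ (λ _ → 0) xs ≡ 0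
∑-zero xs = trans (∑-const 0 xs) (*-zeroʳ (length xs))

∑-+ : ∀ (f g : A → ℕ) xs → ∑ (λ x → f x + g x) xs ≡ ∑ f xs + ∑ g xs
∑-+ f g []       = refl
∑-+ f g (x ∷ xs) = trans (cong (f x + g x +_) (∑-+ f g xs)) (interchange (f x) (g x) (∑ f xs) (∑ g xs))
  where
  interchange : ∀ a b c d → a + b + (c + d) ≡ a + c + (b + d)
  interchange = solve-∀

∑-*ˡ : ∀ k (f : A → ℕ) xs → ∑ (λ x → k * f x) xs ≡ k * ∑ f xs
∑-*ˡ k f []       = sym (*-zeroʳ k)
∑-*ˡ k f (x ∷ xs) = trans (cong (k * f x +_) (∑-*ˡ k f xs)) (sym (*-distribˡ-+ k (f x) (∑ f xs)))

∑-comm : ∀ (h : A → B → ℕ) xs ys → ∑ (λ x → ∑ (h x) ys) xs ≡ ∑ (λ y → ∑ (λ x → h x y) xs) ys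
∑-comm h []       ys = sym (∑-zero ys)
∑-comm h (x ∷ xs) ys = trans (cong (∑ (h x) ys +_) (∑-comm h xs ys)) (sym (∑-+ (h x) _ ys))

-- Counting trees by the shapes of the first root children

data Shape : Set where
  leaf inner : Shape

shapeOf : Tree → Shape
shapeOf (node _ [])      = leaf
shapeOf (node _ (_ ∷ _)) = inner

_==_ : Shape → Shape → Bool
leaf  == leaf  = true
inner == inner = true
_     == _     = false

matches : List Shape → List Tree → Bool
matches []      _        = true
matches (_ ∷ _) []       = false
matches (f ∷ w) (c ∷ cs) = (f == shapeOf c) ∧ matches w cs

indicator : Bool → ℕ
indicator true  = 1
indicator false = 0

#inner #leaf : List Shape → ℕ
#inner []          = 0
#inner (leaf ∷ w)  = #inner w
#inner (inner ∷ w) = suc (#inner w)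
#leaf []          = 0
#leaf (leaf ∷ w)  = suc (#leaf w)
#leaf (inner ∷ w) = #leaf w

-- The patterns v such that inserting a leaf can turn a forest matching v into one matching w.
predecessors : List Shape → List (List Shape)
predecessors []          = []
predecessors (leaf ∷ w)  = w ∷ map (leaf ∷_) (predecessors w)
predecessors (inner ∷ w) = (leaf ∷ w) ∷ map (inner ∷_) (predecessors w)

size : List Tree → ℕ
size cs = length (labelsF cs)

length-slots : ∀ cs → length (slots cs) ≡ suc (2 * size cs)
length-slots [] = refl
length-slots (node b ds ∷ cs) = cong suc (begin
  length (map into (slots ds) ++ map past (slots cs))  ≡⟨ length-++ (map into (slots ds)) ⟩
  length (map into (slots ds)) + length (map past (slots cs))
    ≡⟨ cong₂ _+_ (length-map into (slots ds)) (length-map past (slots cs)) ⟩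
  length (slots ds) + length (slots cs)                ≡⟨ cong₂ _+_ (length-slots ds) (length-slots cs) ⟩
  suc (2 * size ds) + suc (2 * size cs)                ≡⟨ arith (size ds) (size cs) ⟩
  2 * suc (size ds + size cs)                          ≡⟨ cong (λ n → 2 * suc n) (length-++ (labelsF ds)) ⟨
  2 * size (node b ds ∷ cs)                            ∎)
  where
  open ≡-Reasoning
  arith : ∀ m n → suc (2 * m) + suc (2 * n) ≡ 2 * suc (m + n)
  arith = solve-∀

∑-slots-∷ : ∀ {b ds cs} (g : Slot (node b ds ∷ cs) → ℕ) →
  ∑ g (slots (node b ds ∷ cs)) ≡ g front + (∑ (g ∘ into) (slots ds) + ∑ (g ∘ past) (slots cs))
∑-slots-∷ {ds = ds} {cs} g = cong (g front +_) (begin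
  ∑ g (map into (slots ds) ++ map past (slots cs))   ≡⟨ ∑-++ g (map into (slots ds)) _ ⟩
  ∑ g (map into (slots ds)) + ∑ g (map past (slots cs))
    ≡⟨ cong₂ _+_ (∑-map g into (slots ds)) (∑-map g past (slots cs)) ⟩
  ∑ (g ∘ into) (slots ds) + ∑ (g ∘ past) (slots cs)  ∎)
  where open ≡-Reasoning

shapeOf-insertLeaf : ∀ x b {ds} (s : Slot ds) → shapeOf (node b (insertLeaf x s)) ≡ inner
shapeOf-insertLeaf x b front    = refl
shapeOf-insertLeaf x b (into s) = refl
shapeOf-insertLeaf x b (past s) = refl

∑-matches-into : ∀ x f w b ds cs →
  ∑ (λ s → indicator (matches (f ∷ w) (node b (insertLeaf x s) ∷ cs))) (slots ds)
  ≡ suc (2 * size ds) * indicator ((f == inner) ∧ matches w cs)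
∑-matches-into x f w b ds cs = begin
  ∑ (λ s → indicator ((f == shapeOf (node b (insertLeaf x s))) ∧ matches w cs)) (slots ds)
    ≡⟨ ∑-cong (slots ds) (λ {s} _ → cong (λ g → indicator ((f == g) ∧ matches w cs)) (shapeOf-insertLeaf x b s)) ⟩
  ∑ (λ _ → indicator ((f == inner) ∧ matches w cs)) (slots ds)
    ≡⟨ ∑-const _ (slots ds) ⟩
  length (slots ds) * indicator ((f == inner) ∧ matches w cs)
    ≡⟨ cong (_* _) (length-slots ds) ⟩
  suc (2 * size ds) * indicator ((f == inner) ∧ matches w cs) ∎
  where open ≡-Reasoning

matchingInsertions : ℕ → List Shape → List Tree → ℕ
matchingInsertions x w cs = ∑ (λ s → indicator (matches w (insertLeaf x s))) (slots cs)

∑-matches-[] : ∀ f vs → ∑ (λ v → indicator (matches v [])) (map (f ∷_) vs) ≡ 0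
∑-matches-[] f vs = trans (∑-map _ (f ∷_) vs) (∑-zero vs)

-- Σₛ [w matches insertLeaf x s] = Σ_{v ∈ predecessors w} [v matches cs]
--                                  + (2 · size cs + 1 − #inner w − 2 · #leaf w) · [w matches cs],
-- with the subtracted terms moved to the left.
InsertionIdentity : ℕ → List Shape → List Tree → Set
InsertionIdentity x w cs =
  matchingInsertions x w cs + (#inner w + 2 * #leaf w) * indicator (matches w cs)
  ≡ ∑ (λ v → indicator (matches v cs)) (predecessors w) + suc (2 * size cs) * indicator (matches w cs)

insertionIdentity-[] : ∀ x cs → InsertionIdentity x [] cs
insertionIdentity-[] x cs = begin
  ∑ (λ _ → 1) (slots cs) + 0  ≡⟨ +-identityʳ _ ⟩
  ∑ (λ _ → 1) (slots cs)      ≡⟨ ∑-const 1 (slots cs) ⟩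
  length (slots cs) * 1       ≡⟨ cong (_* 1) (length-slots cs) ⟩
  suc (2 * size cs) * 1       ∎
  where open ≡-Reasoning

insertionIdentity-∷-[] : ∀ x f w → InsertionIdentity x (f ∷ w) []
insertionIdentity-∷-[] x leaf w =
  cong₂ _+_ (cong (indicator (matches w []) +_) (sym (∑-matches-[] leaf (predecessors w))))
            (*-zeroʳ (#inner w + 2 * suc (#leaf w)))
insertionIdentity-∷-[] x inner w =
  cong₂ _+_ (sym (∑-matches-[] inner (predecessors w))) (*-zeroʳ (suc (#inner w) + 2 * #leaf w))

insertionIdentity-leaf-leaf : ∀ x w b cs → InsertionIdentity x w cs →
  InsertionIdentity x (leaf ∷ w) (node b [] ∷ cs)
insertionIdentity-leaf-leaf x w b cs identity = begin
  matchingInsertions x (leaf ∷ w) (c ∷ cs) + (i + 2 * suc l) * M    ≡⟨ cong (_+ (i + 2 * suc l) * M) (∑-slots-∷ g) ⟩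
  Mc + S + (i + 2 * suc l) * M                                       ≡⟨ split Mc S M i l ⟩
  Mc + 2 * M + (S + (i + 2 * l) * M)                                 ≡⟨ cong (Mc + 2 * M +_) identity ⟩
  Mc + 2 * M + (Pre + suc (2 * size cs) * M)                         ≡⟨ merge Mc Pre M (size cs) ⟩
  Mc + Pre + suc (2 * suc (size cs)) * M
    ≡⟨ cong (λ p → Mc + p + suc (2 * suc (size cs)) * M) (∑-map _ (leaf ∷_) (predecessors w)) ⟨
  ∑ (λ v → indicator (matches v (c ∷ cs))) (predecessors (leaf ∷ w)) + suc (2 * size (c ∷ cs)) * M ∎
  where
  open ≡-Reasoning
  c = node b []
  i = #inner w
  l = #leaf w
  M = indicator (matches w cs)
  Mc = indicator (matches w (c ∷ cs))
  S = matchingInsertions x w cs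
  Pre = ∑ (λ v → indicator (matches v cs)) (predecessors w)
  g : Slot (c ∷ cs) → ℕ
  g s = indicator (matches (leaf ∷ w) (insertLeaf x s))
  split : ∀ Mc S M i l → Mc + S + (i + 2 * suc l) * M ≡ Mc + 2 * M + (S + (i + 2 * l) * M)
  split = solve-∀
  merge : ∀ Mc Pre M z → Mc + 2 * M + (Pre + suc (2 * z) * M) ≡ Mc + Pre + suc (2 * suc z) * M
  merge = solve-∀

insertionIdentity-leaf-inner : ∀ x w b d ds cs → InsertionIdentity x (leaf ∷ w) (node b (d ∷ ds) ∷ cs)
insertionIdentity-leaf-inner x w b d ds cs = begin
  matchingInsertions x (leaf ∷ w) (c ∷ cs) + (#inner w + 2 * suc (#leaf w)) * 0
    ≡⟨ cong₂ _+_ (∑-slots-∷ g) (*-zeroʳ (#inner w + 2 * suc (#leaf w))) ⟩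
  Mc + (∑ (g ∘ into) (slots (d ∷ ds)) + ∑ (λ _ → 0) (slots cs)) + 0
    ≡⟨ cong (λ k → Mc + k + 0) (cong₂ _+_ into-sum (∑-zero (slots cs))) ⟩
  Mc + 0 + 0
    ≡⟨ cong₂ (λ k z → Mc + k + z) (trans (∑-map _ (leaf ∷_) (predecessors w)) (∑-zero (predecessors w)))
                                 (*-zeroʳ (suc (2 * size (c ∷ cs)))) ⟨
  ∑ (λ v → indicator (matches v (c ∷ cs))) (predecessors (leaf ∷ w)) + suc (2 * size (c ∷ cs)) * 0 ∎
  where
  open ≡-Reasoning
  c = node b (d ∷ ds)
  Mc = indicator (matches w (c ∷ cs))
  g : Slot (c ∷ cs) → ℕ
  g s = indicator (matches (leaf ∷ w) (insertLeaf x s))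
  into-sum : ∑ (g ∘ into) (slots (d ∷ ds)) ≡ 0
  into-sum = trans (∑-matches-into x leaf w b (d ∷ ds) cs) (*-zeroʳ (suc (2 * size (d ∷ ds))))

insertionIdentity-inner-leaf : ∀ x w b cs → InsertionIdentity x (inner ∷ w) (node b [] ∷ cs)
insertionIdentity-inner-leaf x w b cs = begin
  matchingInsertions x (inner ∷ w) (c ∷ cs) + (suc (#inner w) + 2 * #leaf w) * 0
    ≡⟨ cong₂ _+_ (∑-slots-∷ g) (*-zeroʳ (suc (#inner w) + 2 * #leaf w)) ⟩
  M + 0 + ∑ (λ _ → 0) (slots cs) + 0
    ≡⟨ cong (λ k → M + 0 + k + 0) (∑-zero (slots cs)) ⟩
  M + 0 + 0 + 0
    ≡⟨ cong (λ k → k + 0 + 0) (+-identityʳ M) ⟩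
  M + 0 + 0
    ≡⟨ cong₂ (λ k z → M + k + z) (trans (∑-map _ (inner ∷_) (predecessors w)) (∑-zero (predecessors w)))
                                (*-zeroʳ (suc (2 * size (c ∷ cs)))) ⟨
  ∑ (λ v → indicator (matches v (c ∷ cs))) (predecessors (inner ∷ w)) + suc (2 * size (c ∷ cs)) * 0 ∎
  where
  open ≡-Reasoning
  c = node b []
  M = indicator (matches w cs)
  g : Slot (c ∷ cs) → ℕ
  g s = indicator (matches (inner ∷ w) (insertLeaf x s))

insertionIdentity-inner-inner : ∀ x w b d ds cs → InsertionIdentity x w cs →
  InsertionIdentity x (inner ∷ w) (node b (d ∷ ds) ∷ cs)
insertionIdentity-inner-inner x w b d ds cs identity = begin
  matchingInsertions x (inner ∷ w) (c ∷ cs) + (suc i + 2 * l) * M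
    ≡⟨ cong (_+ (suc i + 2 * l) * M) (∑-slots-∷ g) ⟩
  0 + (∑ (g ∘ into) (slots (d ∷ ds)) + S) + (suc i + 2 * l) * M
    ≡⟨ cong (λ k → k + S + (suc i + 2 * l) * M) (∑-matches-into x inner w b (d ∷ ds) cs) ⟩
  suc (2 * z) * M + S + (suc i + 2 * l) * M              ≡⟨ split z S M i l ⟩
  2 * suc z * M + (S + (i + 2 * l) * M)                  ≡⟨ cong (2 * suc z * M +_) identity ⟩
  2 * suc z * M + (Pre + suc (2 * size cs) * M)          ≡⟨ merge z Pre M (size cs) ⟩
  Pre + suc (2 * suc (z + size cs)) * M
    ≡⟨ cong₂ (λ p y → p + suc (2 * suc y) * M) (∑-map _ (inner ∷_) (predecessors w)) (length-++ (labelsF (d ∷ ds))) ⟨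
  ∑ (λ v → indicator (matches v (c ∷ cs))) (predecessors (inner ∷ w)) + suc (2 * size (c ∷ cs)) * M ∎
  where
  open ≡-Reasoning
  c = node b (d ∷ ds)
  i = #inner w
  l = #leaf w
  z = size (d ∷ ds)
  M = indicator (matches w cs)
  S = matchingInsertions x w cs
  Pre = ∑ (λ v → indicator (matches v cs)) (predecessors w)
  g : Slot (c ∷ cs) → ℕ
  g s = indicator (matches (inner ∷ w) (insertLeaf x s))
  split : ∀ zd S M i l → suc (2 * zd) * M + S + (suc i + 2 * l) * M ≡ 2 * suc zd * M + (S + (i + 2 * l) * M)
  split = solve-∀
  merge : ∀ zd Pre M z → 2 * suc zd * M + (Pre + suc (2 * z) * M) ≡ Pre + suc (2 * suc (zd + z)) * M
  merge = solve-∀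

insertionIdentity : ∀ x w cs → InsertionIdentity x w cs
insertionIdentity x []          cs                      = insertionIdentity-[] x cs
insertionIdentity x (f ∷ w)     []                      = insertionIdentity-∷-[] x f w
insertionIdentity x (leaf ∷ w)  (node b [] ∷ cs)       =
  insertionIdentity-leaf-leaf x w b cs (insertionIdentity x w cs)
insertionIdentity x (leaf ∷ w)  (node b (d ∷ ds) ∷ cs) = insertionIdentity-leaf-inner x w b d ds cs
insertionIdentity x (inner ∷ w) (node b [] ∷ cs)       = insertionIdentity-inner-leaf x w b cs
insertionIdentity x (inner ∷ w) (node b (d ∷ ds) ∷ cs) =
  insertionIdentity-inner-inner x w b d ds cs (insertionIdentity x w cs)

count : List Shape → ℕ → ℕ
count w n = ∑ (λ t → indicator (matches w (children t))) (trees n)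

ordered⇒size≡ : ∀ {n t} → IncreasingOrderedTree n t → size (children t) ≡ n
ordered⇒size≡ {n} {node _ _} (_ , σ) = suc-injective (trans (↭-length σ) (length-upTo (suc n)))

count-suc : ∀ w n → count w (suc n) ≡ ∑ (λ t → matchingInsertions (suc n) w (children t)) (trees n)
count-suc w n = trans (∑-concatMap M (extensions (suc n)) (trees n))
                      (∑-cong (trees n) (λ {t} _ → ∑-map M (graft (suc n) t) (slots (children t))))
  where
  M : Tree → ℕ
  M t = indicator (matches w (children t))

count-rec : ∀ w n →
  count w (suc n) + (#inner w + 2 * #leaf w) * count w n
  ≡ ∑ (λ v → count v n) (predecessors w) + suc (2 * n) * count w n
count-rec w n = begin
  count w (suc n) + k * count w n
    ≡⟨ cong₂ _+_ (count-suc w n) (sym (∑-*ˡ k M (trees n))) ⟩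
  ∑ (λ t → matchingInsertions (suc n) w (children t)) (trees n) + ∑ (λ t → k * M t) (trees n)
    ≡⟨ ∑-+ _ _ (trees n) ⟨
  ∑ (λ t → matchingInsertions (suc n) w (children t) + k * M t) (trees n)
    ≡⟨ ∑-cong (trees n) (λ {t} t∈ → trans (insertionIdentity (suc n) w (children t))
                                         (cong (λ z → Pre t + suc (2 * z) * M t) (ordered⇒size≡ (trees-sound n t∈)))) ⟩
  ∑ (λ t → Pre t + suc (2 * n) * M t) (trees n)
    ≡⟨ ∑-+ Pre (λ t → suc (2 * n) * M t) (trees n) ⟩
  ∑ Pre (trees n) + ∑ (λ t → suc (2 * n) * M t) (trees n)
    ≡⟨ cong₂ _+_ (∑-comm (λ t v → indicator (matches v (children t))) (trees n) (predecessors w))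
                 (∑-*ˡ (suc (2 * n)) M (trees n)) ⟩
  ∑ (λ v → count v n) (predecessors w) + suc (2 * n) * count w n ∎
  where
  open ≡-Reasoning
  k = #inner w + 2 * #leaf w
  M Pre : Tree → ℕ
  M t = indicator (matches w (children t))
  Pre t = ∑ (λ v → indicator (matches v (children t))) (predecessors w)

-- The closed form

n<k⇒nP′k≡0 : ∀ {n k} → n < k → n P′ k ≡ 0
n<k⇒nP′k≡0 {n} {suc k} (s≤s n≤k) = cong (_* (n P′ k)) (m≤n⇒m∸n≡0 n≤k)

[1+n]P′[1+k]≡[1+n]*nP′k : ∀ n k → suc n P′ suc k ≡ suc n * (n P′ k)
[1+n]P′[1+k]≡[1+n]*nP′k n zero    = refl
[1+n]P′[1+k]≡[1+n]*nP′k n (suc k) =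
  trans (cong ((n ∸ k) *_) ([1+n]P′[1+k]≡[1+n]*nP′k n k)) (x∙yz≈y∙xz (n ∸ k) (suc n) (n P′ k))

nP′[1+k]+[1+k]*nP′k≡[1+n]P′[1+k] : ∀ n k → n P′ suc k + suc k * (n P′ k) ≡ suc n P′ suc k
nP′[1+k]+[1+k]*nP′k≡[1+n]P′[1+k] n k with k ≤? n
... | yes k≤n = begin
  (n ∸ k) * (n P′ k) + suc k * (n P′ k)  ≡⟨ *-distribʳ-+ (n P′ k) (n ∸ k) (suc k) ⟨
  (n ∸ k + suc k) * (n P′ k)             ≡⟨ cong (_* (n P′ k)) (trans (+-suc (n ∸ k) k) (cong suc (m∸n+n≡m k≤n))) ⟩
  suc n * (n P′ k)                       ≡⟨ [1+n]P′[1+k]≡[1+n]*nP′k n k ⟨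
  suc n P′ suc k                         ∎
  where open ≡-Reasoning
... | no k≰n = begin
  n P′ suc k + suc k * (n P′ k)  ≡⟨ cong₂ (λ u v → u + suc k * v) (n<k⇒nP′k≡0 (<-trans n<k (n<1+n k))) (n<k⇒nP′k≡0 n<k) ⟩
  suc k * 0                      ≡⟨ *-zeroʳ (suc k) ⟩
  0                              ≡⟨ n<k⇒nP′k≡0 (s≤s n<k) ⟨
  suc n P′ suc k                 ∎
  where
  open ≡-Reasoning
  n<k = ≰⇒> k≰n

-- _P′_ also vanishes for k > n, so the boundary test in _P_ changes nothing.
nPk≡nP′k : ∀ n k → n P k ≡ n P′ k
nPk≡nP′k n k with k ≤ᵇ n in eq
... | true  = refl
... | false = sym (n<k⇒nP′k≡0 (≰⇒> {k} {n} (λ k≤n → subst T eq (≤⇒≤ᵇ k≤n))))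

flourishingCount : ℕ → ℕ → ℕ
flourishingCount r n = oddDoubleFactorial (n ∸ r) * ((n ∸ r) P r)

flourishingCount-vanishes : ∀ r {n} → n < 2 * r → flourishingCount r n ≡ 0
flourishingCount-vanishes (suc r) {n} n<2r =
  trans (cong (oddDoubleFactorial (n ∸ suc r) *_) (k>n⇒nPk≡0 (m<n+o⇒m∸n<o n (suc r) n<r+r)))
        (*-zeroʳ (oddDoubleFactorial (n ∸ suc r)))
  where
  n<r+r : n < suc r + suc r
  n<r+r = subst (λ k → n < suc r + k) (+-identityʳ (suc r)) n<2r

flourishingCount-at : ∀ r k → flourishingCount r (r + k) ≡ oddDoubleFactorial k * (k P′ r)
flourishingCount-at r k =
  trans (cong (λ m → oddDoubleFactorial m * (m P r)) (m+n∸m≡n r k)) (cong (oddDoubleFactorial k *_) (nPk≡nP′k k r))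

FlourishingRecurrence : ℕ → ℕ → Set
FlourishingRecurrence r m =
  flourishingCount r (suc m) + r * flourishingCount r m
  ≡ r * m * flourishingCount (pred r) (pred m) + suc (2 * m) * flourishingCount r m

flourishingRecurrence-vanishing : ∀ r m → m ≤ 2 * r → FlourishingRecurrence (suc r) m
flourishingRecurrence-vanishing r m m≤2r = begin
  flourishingCount (suc r) (suc m) + suc r * flourishingCount (suc r) m
    ≡⟨ cong₂ (λ u v → u + suc r * v) (flourishingCount-vanishes (suc r) (<2[1+r] (s≤s m≤2r))) vanishes ⟩
  suc r * 0
    ≡⟨ *-zeroʳ (suc r) ⟩
  0
    ≡⟨ cong₂ _+_ (vanishes-pred m m≤2r) (trans (cong (suc (2 * m) *_) vanishes) (*-zeroʳ (suc (2 * m)))) ⟨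
  suc r * m * flourishingCount r (pred m) + suc (2 * m) * flourishingCount (suc r) m ∎
  where
  open ≡-Reasoning
  <2[1+r] : ∀ {n} → n ≤ suc (2 * r) → n < 2 * suc r
  <2[1+r] {n} n≤ = subst (n <_) (sym (*-suc 2 r)) (s≤s n≤)
  vanishes : flourishingCount (suc r) m ≡ 0
  vanishes = flourishingCount-vanishes (suc r) (<2[1+r] (m≤n⇒m≤1+n m≤2r))
  vanishes-pred : ∀ m → m ≤ 2 * r → suc r * m * flourishingCount r (pred m) ≡ 0
  vanishes-pred zero    _    = cong (_* flourishingCount r 0) (*-zeroʳ (suc r))
  vanishes-pred (suc m) m<2r =
    trans (cong (suc r * suc m *_) (flourishingCount-vanishes r m<2r)) (*-zeroʳ (suc r * suc m))

-- With k = r + j, all three counts are multiples of (2k − 1)!! · (k P′ r),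
-- so the recurrence reduces to a polynomial identity.
flourishingRecurrence-large : ∀ r j → FlourishingRecurrence (suc r) (suc r + (r + j))
flourishingRecurrence-large r j = begin
  flourishingCount (suc r) (suc m) + suc r * flourishingCount (suc r) m
    ≡⟨ cong₂ (λ u v → u + suc r * v) at-suc-m at-m ⟩
  suc (2 * k) * O * (suc k * Q) + suc r * (O * (j * Q))
    ≡⟨ polynomial r j O Q ⟩
  suc r * m * (O * Q) + suc (2 * m) * (O * (j * Q))
    ≡⟨ cong₂ (λ u v → suc r * m * u + suc (2 * m) * v) (flourishingCount-at r k) at-m ⟨
  suc r * m * flourishingCount r (pred m) + suc (2 * m) * flourishingCount (suc r) m ∎
  where
  open ≡-Reasoning
  k = r + j
  m = suc r + k
  O = oddDoubleFactorial k
  Q = k P′ r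
  at-m : flourishingCount (suc r) m ≡ O * (j * Q)
  at-m = trans (flourishingCount-at (suc r) k) (cong (λ d → O * (d * Q)) (m+n∸m≡n r j))
  at-suc-m : flourishingCount (suc r) (suc m) ≡ suc (2 * k) * O * (suc k * Q)
  at-suc-m = begin
    flourishingCount (suc r) (suc m)               ≡⟨ cong (flourishingCount (suc r)) (+-suc (suc r) k) ⟨
    flourishingCount (suc r) (suc r + suc k)       ≡⟨ flourishingCount-at (suc r) (suc k) ⟩
    oddDoubleFactorial (suc k) * (suc k P′ suc r)  ≡⟨ cong (oddDoubleFactorial (suc k) *_) ([1+n]P′[1+k]≡[1+n]*nP′k k r) ⟩
    suc (2 * k) * O * (suc k * Q)                  ∎
  polynomial : ∀ r j O Q →
    suc (2 * (r + j)) * O * (suc (r + j) * Q) + suc r * (O * (j * Q))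
    ≡ suc r * (suc r + (r + j)) * (O * Q) + suc (2 * (suc r + (r + j))) * (O * (j * Q))
  polynomial = solve-∀

flourishingCount-rec : ∀ r m → FlourishingRecurrence r m
flourishingCount-rec zero    m = trans (+-identityʳ _) (*-assoc (suc (2 * m)) (oddDoubleFactorial m) 1)
flourishingCount-rec (suc r) m with 2 * r <? m
... | no  2r≮m = flourishingRecurrence-vanishing r m (≮⇒≥ 2r≮m)
... | yes 2r<m with m≤n⇒∃[o]m+o≡n 2r<m
...   | j , 2r<m+j≡m =
  subst (FlourishingRecurrence (suc r)) (trans (split r j) 2r<m+j≡m) (flourishingRecurrence-large r j)
  where
  split : ∀ r j → suc r + (r + j) ≡ suc (2 * r) + j
  split = solve-∀

patternCount : ℕ → ℕ → ℕ → ℕ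
patternCount a b n = (n P′ b) * flourishingCount a (n ∸ b)

patternCount-suc : ∀ a b n →
  patternCount a b (suc n) ≡ (n P′ b) * flourishingCount a (suc n ∸ b) + b * patternCount a (pred b) n
patternCount-suc a zero    n = sym (+-identityʳ _)
patternCount-suc a (suc b) n = begin
  (suc n P′ suc b) * X                            ≡⟨ cong (_* X) (nP′[1+k]+[1+k]*nP′k≡[1+n]P′[1+k] n b) ⟨
  (n P′ suc b + suc b * (n P′ b)) * X             ≡⟨ *-distribʳ-+ X (n P′ suc b) _ ⟩
  (n P′ suc b) * X + suc b * (n P′ b) * X         ≡⟨ cong ((n P′ suc b) * X +_) (*-assoc (suc b) (n P′ b) X) ⟩
  (n P′ suc b) * X + suc b * patternCount a b n  ∎
  where
  open ≡-Reasoning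
  X = flourishingCount a (n ∸ b)

PatternRecurrence : ℕ → ℕ → ℕ → Set
PatternRecurrence a b n =
  patternCount a b (suc n) + (a + 2 * b) * patternCount a b n
  ≡ a * patternCount (pred a) (suc b) n + b * patternCount a (pred b) n + suc (2 * n) * patternCount a b n

patternRecurrence-vanishing : ∀ a b n → n < b → PatternRecurrence a b n
patternRecurrence-vanishing a b n n<b = begin
  patternCount a b (suc n) + (a + 2 * b) * patternCount a b n
    ≡⟨ cong (_+ (a + 2 * b) * patternCount a b n) (patternCount-suc a b n) ⟩
  F * X₁ + b * G + (a + 2 * b) * (F * X₀)
    ≡⟨ cong (λ f → f * X₁ + b * G + (a + 2 * b) * (f * X₀)) F≡0 ⟩
  0 * X₁ + b * G + (a + 2 * b) * (0 * X₀)
    ≡⟨ vanish X₁ X₀ Y G a b (n ∸ b) n ⟩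
  a * ((n ∸ b) * 0 * Y) + b * G + suc (2 * n) * (0 * X₀)
    ≡⟨ cong (λ f → a * ((n ∸ b) * f * Y) + b * G + suc (2 * n) * (f * X₀)) F≡0 ⟨
  a * patternCount (pred a) (suc b) n + b * G + suc (2 * n) * patternCount a b n ∎
  where
  open ≡-Reasoning
  F = n P′ b
  G = patternCount a (pred b) n
  X₁ = flourishingCount a (suc n ∸ b)
  X₀ = flourishingCount a (n ∸ b)
  Y = flourishingCount (pred a) (n ∸ suc b)
  F≡0 : F ≡ 0
  F≡0 = n<k⇒nP′k≡0 n<b
  vanish : ∀ X₁ X₀ Y G a b d n →
    0 * X₁ + b * G + (a + 2 * b) * (0 * X₀) ≡ a * (d * 0 * Y) + b * G + suc (2 * n) * (0 * X₀)
  vanish = solve-∀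

patternRecurrence-large : ∀ a b m → PatternRecurrence a b (b + m)
patternRecurrence-large a b m = begin
  patternCount a b (suc n) + (a + 2 * b) * patternCount a b n
    ≡⟨ cong (_+ (a + 2 * b) * patternCount a b n) (patternCount-suc a b n) ⟩
  F * flourishingCount a (suc n ∸ b) + b * G + (a + 2 * b) * (F * flourishingCount a (n ∸ b))
    ≡⟨ cong₂ (λ u v → F * flourishingCount a u + b * G + (a + 2 * b) * (F * flourishingCount a v)) suc-n∸b n∸b ⟩
  F * X₁ + b * G + (a + 2 * b) * (F * X₀)
    ≡⟨ factor F X₁ X₀ G a b ⟩
  F * (X₁ + a * X₀) + (b * G + 2 * b * (F * X₀))
    ≡⟨ cong (λ u → F * u + (b * G + 2 * b * (F * X₀))) (flourishingCount-rec a m) ⟩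
  F * (a * m * Y + suc (2 * m) * X₀) + (b * G + 2 * b * (F * X₀))
    ≡⟨ unfactor F X₀ Y G a b m ⟩
  a * (m * F * Y) + b * G + suc (2 * n) * (F * X₀)
    ≡⟨ cong₂ (λ u v → a * (u * F * flourishingCount (pred a) v) + b * G + suc (2 * n) * (F * flourishingCount a u))
             (sym n∸b) n∸[1+b] ⟩
  a * patternCount (pred a) (suc b) n + b * G + suc (2 * n) * patternCount a b n ∎
  where
  open ≡-Reasoning
  n = b + m
  F = n P′ b
  G = patternCount a (pred b) n
  X₁ = flourishingCount a (suc m)
  X₀ = flourishingCount a m
  Y = flourishingCount (pred a) (pred m)
  n∸b : n ∸ b ≡ m
  n∸b = m+n∸m≡n b m
  suc-n∸b : suc n ∸ b ≡ suc m
  suc-n∸b = trans (cong (_∸ b) (sym (+-suc b m))) (m+n∸m≡n b (suc m))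
  n∸[1+b] : pred m ≡ n ∸ suc b
  n∸[1+b] = trans (cong pred (sym n∸b)) (pred[m∸n]≡m∸[1+n] n b)
  factor : ∀ F X₁ X₀ G a b →
    F * X₁ + b * G + (a + 2 * b) * (F * X₀) ≡ F * (X₁ + a * X₀) + (b * G + 2 * b * (F * X₀))
  factor = solve-∀
  unfactor : ∀ F X₀ Y G a b m →
    F * (a * m * Y + suc (2 * m) * X₀) + (b * G + 2 * b * (F * X₀))
    ≡ a * (m * F * Y) + b * G + suc (2 * (b + m)) * (F * X₀)
  unfactor = solve-∀

patternCount-rec : ∀ a b n → PatternRecurrence a b n
patternCount-rec a b n with b ≤? n
... | no  b≰n = patternRecurrence-vanishing a b n (≰⇒> b≰n)
... | yes b≤n with m≤n⇒∃[o]m+o≡n b≤n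
...   | m , b+m≡n = subst (PatternRecurrence a b) b+m≡n (patternRecurrence-large a b m)

n*f[1+pred[n]]≡n*f[n] : ∀ n (f : ℕ → ℕ) → n * f (suc (pred n)) ≡ n * f n
n*f[1+pred[n]]≡n*f[n] zero    f = refl
n*f[1+pred[n]]≡n*f[n] (suc n) f = refl

∑-predecessors : ∀ (g : ℕ → ℕ → ℕ) w →
  ∑ (λ v → g (#inner v) (#leaf v)) (predecessors w)
  ≡ #inner w * g (pred (#inner w)) (suc (#leaf w)) + #leaf w * g (#inner w) (pred (#leaf w))
∑-predecessors g [] = refl
∑-predecessors g (leaf ∷ w) = begin
  g i l + ∑ (λ v → g (#inner v) (#leaf v)) (map (leaf ∷_) (predecessors w))
    ≡⟨ cong (g i l +_) (trans (∑-map _ (leaf ∷_) (predecessors w)) (∑-predecessors (λ a b → g a (suc b)) w)) ⟩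
  g i l + (i * g (pred i) (suc (suc l)) + l * g i (suc (pred l)))
    ≡⟨ cong (λ z → g i l + (i * g (pred i) (suc (suc l)) + z)) (n*f[1+pred[n]]≡n*f[n] l (g i)) ⟩
  g i l + (i * g (pred i) (suc (suc l)) + l * g i l)
    ≡⟨ swap (g i l) (i * g (pred i) (suc (suc l))) (l * g i l) ⟩
  i * g (pred i) (suc (suc l)) + suc l * g i l ∎
  where
  open ≡-Reasoning
  i = #inner w
  l = #leaf w
  swap : ∀ x y z → x + (y + z) ≡ y + (x + z)
  swap = solve-∀
∑-predecessors g (inner ∷ w) = begin
  g i (suc l) + ∑ (λ v → g (#inner v) (#leaf v)) (map (inner ∷_) (predecessors w))
    ≡⟨ cong (g i (suc l) +_) (trans (∑-map _ (inner ∷_) (predecessors w)) (∑-predecessors (λ a b → g (suc a) b) w)) ⟩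
  g i (suc l) + (i * g (suc (pred i)) (suc l) + l * g (suc i) (pred l))
    ≡⟨ cong (λ z → g i (suc l) + (z + l * g (suc i) (pred l))) (n*f[1+pred[n]]≡n*f[n] i (λ a → g a (suc l))) ⟩
  g i (suc l) + (i * g i (suc l) + l * g (suc i) (pred l))
    ≡⟨ +-assoc (g i (suc l)) _ _ ⟨
  suc i * g i (suc l) + l * g (suc i) (pred l) ∎
  where
  open ≡-Reasoning
  i = #inner w
  l = #leaf w

count≡patternCount : ∀ w n → count w n ≡ patternCount (#inner w) (#leaf w) n
count≡patternCount []          zero = refl
count≡patternCount (leaf ∷ w)  zero =
  sym (cong (_* flourishingCount (#inner w) 0) (n<k⇒nP′k≡0 {0} {suc (#leaf w)} (s≤s z≤n)))
count≡patternCount (inner ∷ w) zero =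
  sym (trans (cong (λ m → (0 P′ #leaf w) * flourishingCount (suc (#inner w)) m) (0∸n≡0 (#leaf w)))
             (*-zeroʳ (0 P′ #leaf w)))
count≡patternCount w (suc n) = +-cancelʳ-≡ (k * pc n) (count w (suc n)) (pc (suc n)) (begin
  count w (suc n) + k * pc n                                 ≡⟨ cong (λ c → count w (suc n) + k * c) (count≡patternCount w n) ⟨
  count w (suc n) + k * count w n                            ≡⟨ count-rec w n ⟩
  ∑ (λ v → count v n) (predecessors w) + suc (2 * n) * count w n
    ≡⟨ cong₂ (λ s c → s + suc (2 * n) * c)
             (trans (∑-cong (predecessors w) (λ {v} _ → count≡patternCount v n))
                    (∑-predecessors (λ a b → patternCount a b n) w))
             (count≡patternCount w n) ⟩
  #inner w * patternCount (pred (#inner w)) (suc (#leaf w)) n + #leaf w * patternCount (#inner w) (pred (#leaf w)) n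
    + suc (2 * n) * pc n                                     ≡⟨ patternCount-rec (#inner w) (#leaf w) n ⟨
  pc (suc n) + k * pc n                                      ∎)
  where
  open ≡-Reasoning
  k = #inner w + 2 * #leaf w
  pc = patternCount (#inner w) (#leaf w)

flourishing⇒matches : ∀ r cs → r ≤ length cs → All NotLeaf (take r cs) → T (matches (replicate r inner) cs)
flourishing⇒matches zero    cs                     _         _        = tt
flourishing⇒matches (suc r) (node _ (_ ∷ _) ∷ cs) (s≤s r≤) (_ ∷ nl) = flourishing⇒matches r cs r≤ nl

matches⇒flourishing : ∀ r cs → T (matches (replicate r inner) cs) → r ≤ length cs × All NotLeaf (take r cs)
matches⇒flourishing zero    cs                     _ = z≤n , []
matches⇒flourishing (suc r) (node _ (_ ∷ _) ∷ cs) m with matches⇒flourishing r cs m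
... | r≤ , nl = s≤s r≤ , s≤s z≤n ∷ nl

length-filter≡∑-indicator : ∀ (p : A → Bool) xs → length (filter (T? ∘ p) xs) ≡ ∑ (indicator ∘ p) xs
length-filter≡∑-indicator p [] = refl
length-filter≡∑-indicator p (x ∷ xs) with p x
... | true  = cong suc (length-filter≡∑-indicator p xs)
... | false = length-filter≡∑-indicator p xs

#inner-replicate : ∀ r → #inner (replicate r inner) ≡ r
#inner-replicate zero    = refl
#inner-replicate (suc r) = cong suc (#inner-replicate r)

#leaf-replicate : ∀ r → #leaf (replicate r inner) ≡ 0
#leaf-replicate zero    = refl
#leaf-replicate (suc r) = #leaf-replicate r

flourishing-trees : ∀ r n → NumberOf (λ t → IncreasingOrderedTree n t × Flourishing r t) (flourishingCount r n)
flourishing-trees r n =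
  filter (T? ∘ p) (trees n) , Unique.filter⁺ (T? ∘ p) (trees-unique n) , (λ t → mk⇔ to from) , counted
  where
  p : Tree → Bool
  p t = matches (replicate r inner) (children t)
  to : ∀ {t} → t ∈ filter (T? ∘ p) (trees n) → IncreasingOrderedTree n t × Flourishing r t
  to {t} t∈ with ∈-filter⁻ (T? ∘ p) t∈
  ... | t∈trees , pt = trees-sound n t∈trees , matches⇒flourishing r (children t) pt
  from : ∀ {t} → IncreasingOrderedTree n t × Flourishing r t → t ∈ filter (T? ∘ p) (trees n)
  from {t} (ordered , r≤ , nl) =
    ∈-filter⁺ (T? ∘ p) (trees-complete n ordered) (flourishing⇒matches r (children t) r≤ nl)
  counted : length (filter (T? ∘ p) (trees n)) ≡ flourishingCount r n
  counted = begin
    length (filter (T? ∘ p) (trees n))  ≡⟨ length-filter≡∑-indicator p (trees n) ⟩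
    count (replicate r inner) n         ≡⟨ count≡patternCount (replicate r inner) n ⟩
    patternCount (#inner (replicate r inner)) (#leaf (replicate r inner)) n
      ≡⟨ cong₂ (λ a b → patternCount a b n) (#inner-replicate r) (#leaf-replicate r) ⟩
    patternCount r 0 n                  ≡⟨ *-identityˡ (flourishingCount r n) ⟩
    flourishingCount r n                ∎
    where open ≡-Reasoning

lemma5p6 : (r n : ℕ) →
    (2 * r ≤ n →
      NumberOf (λ t → IncreasingOrderedTree n t × Flourishing r t)
               (oddDoubleFactorial (n ∸ r) * ((n ∸ r) P r)))
    × (n < 2 * r →
      NumberOf (λ t → IncreasingOrderedTree n t × Flourishing r t) 0)
lemma5p6 r n =
  (λ _ → flourishing-trees r n) ,
  (λ n<2r → subst (NumberOf _) (flourishingCount-vanishes r n<2r) (flourishing-trees r n))
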